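{- Let $w=aub$ be a proper Christoffel word with $u=\psi(v)$, and let $(\alpha_0,\alpha_1,\ldots,\alpha_n)$, $n\geq0$, be the integral representation of $v$. Then $$|w|=K[\alpha_0+1,\alpha_1,\ldots,\alpha_{n-1},\alpha_n+1],$$ where for $n=0$ the right-hand side means $K[\alpha_0+1,1]=K[\alpha_0+2]$.
   Context: Let $\mathcal{A}=\{a,b\}$. $w^{(+)}$ is the shortest palindrome having $w$ as a prefix; $\psi(\varepsilon)=\varepsilon$, $\psi(vx)=(\psi(v)x)^{(+)}$. For coprime positive integers $p,q$ with $N=p+q$, the Christoffel word of slope $p/q$ is $x_1\cdots x_N$ with $x_i=a$ if $ip\bmod N>(i-1)p\bmod N$ and $x_i=b$ otherwise; these are the proper Christoffel words, and each is uniquely of the form $a\psi(v)b$. Every $v\in\mathcal{A}^*$ is uniquely written $v=b^{\alpha_0}a^{\alpha_1}b^{\alpha_2}\cdots a^{\alpha_{m-1}}b^{\alpha_m}$ with $m$ even, $\alpha_i>0$ for $1\leq i\leq m-1$, $\alpha_0,\alpha_m\geq0$; its integral representation is $(\alpha_0,\ldots,\alpha_n)$ with $n=m$ if $\alpha_m>0$ and $n=m-1$ otherwise. Continuants are defined by $K[\,]=1$, $K[a_0]=a_0$, and $K[a_0,\ldots,a_n]=a_nK[a_0,\ldots,a_{n-1}]+K[a_0,\ldots,a_{n-2}]$ for $n\geq1$. -}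

module Defs where

open import Data.Nat using (ℕ; zero; suc; _+_; _*_; _<_; _≤_; _<ᵇ_)
open import Data.Nat.DivMod using (_%_)
open import Data.Bool using (if_then_else_)
open import Data.List using (List; []; _∷_; _++_; reverse; map; upTo; length; take; replicate)
open import Data.List.Relation.Unary.All using (All)
open import Data.Vec using (Vec; lookup; toList)
open import Data.Fin using (Fin; toℕ; fromℕ)
open import Data.Product using (Σ; ∃; _×_)
open import Data.Sum using (_⊎_)
open import Relation.Binary.PropositionalEquality using (_≡_)

data Letter : Set where
  a b : Letter

Word : Set
Word = List Letter

flipL : Letter → Letter
flipL a = b
flipL b = a

Palindrome : Word → Set
Palindrome z = reverse z ≡ z

IsPrefix : Word → Word → Set
IsPrefix w z = ∃ λ t → z ≡ w ++ t

IsPalClosure : Word → Word → Set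
IsPalClosure w z =
  Palindrome z × IsPrefix w z ×
  (∀ z' → Palindrome z' → IsPrefix w z' → length z ≤ length z')

-- IsPsi v u  means  u = ψ(v):  ψ(ε) = ε,  ψ(vx) = (ψ(v)x)^(+)
data IsPsi : Word → Word → Set where
  psi-ε    : IsPsi [] []
  psi-step : ∀ {v u z} (x : Letter) → IsPsi v u →
             IsPalClosure (u ++ x ∷ []) z → IsPsi (v ++ x ∷ []) z

-- Christoffel word of slope p/q, N = p + q:
-- x_i = a if i p mod N > (i-1) p mod N, else b   (i = 1..N)
christoffelAux : ℕ → ℕ → Word
christoffelAux zero    p = []
christoffelAux (suc n) p =
  map (λ j → if ((j * p) % suc n) <ᵇ ((suc j * p) % suc n) then a else b)
      (upTo (suc n))

christoffel : ℕ → ℕ → Word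
christoffel p q = christoffelAux (p + q) p

expandFrom : Letter → List ℕ → Word
expandFrom x []       = []
expandFrom x (k ∷ ks) = replicate k x ++ expandFrom (flipL x) ks

Even : ℕ → Set
Even m = ∃ λ k → m ≡ 2 * k

IsDecomposition : Word → (m : ℕ) → Vec ℕ (suc m) → Set
IsDecomposition v m β =
  Even m ×
  (∀ (i : Fin (suc m)) → 1 ≤ toℕ i → toℕ i < m → 0 < lookup β i) ×
  v ≡ expandFrom b (toList β)

IntegralRep : Word → List ℕ → Set
IntegralRep v αs =
  Σ ℕ λ m → Σ (Vec ℕ (suc m)) λ β → IsDecomposition v m β ×
    ((0 < lookup β (fromℕ m) × αs ≡ toList β) ⊎
     (lookup β (fromℕ m) ≡ 0 × αs ≡ take m (toList β)))

-- Continuants: K[] = 1, K[a0] = a0,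
-- K[a0..an] = an K[a0..a(n-1)] + K[a0..a(n-2)].
-- Krev works on the reversed list (last element first).
Krev : List ℕ → ℕ
Krev []           = 1
Krev (x ∷ [])     = x
Krev (x ∷ y ∷ rs) = x * Krev (y ∷ rs) + Krev rs

K : List ℕ → ℕ
K xs = Krev (reverse xs)

bumpLast : ℕ → List ℕ → List ℕ
bumpLast x []       = suc x ∷ []
bumpLast x (y ∷ ys) = x ∷ bumpLast y ys

-- The argument list [α0+1, α1, ..., α(n-1), αn+1] for the representation
-- (α0, α1, ..., αn); for n = 0 it is [α0+1, 1] as in the paper.
contArgs : ℕ → List ℕ → List ℕ
contArgs α₀ []       = suc α₀ ∷ 1 ∷ []
contArgs α₀ (y ∷ ys) = suc α₀ ∷ bumpLast y ys

module Submission where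

-- The proof tracks, along the iterated palindromic closure ψ, a pair
-- (A , B) of natural numbers that starts at (1 , 1) and evolves like the Stern–Brocot tree:
-- appending the letter a maps (A , B) to (A + B , B), appending b maps it to (A , A + B).
--
--  1. Word combinatorics: comparing prefixes of one word, mirror images of palindromes.
--  2. Justin-type length formula: for a palindrome u, |(ux)⁺| = 2|u| + 2 − n, where n is the
--     "x-overlap" of u (two plus the length of the longest palindromic prefix s of u that is
--     followed by x in u; one if there is none), together with the change of the a- and
--     b-overlaps when passing from u to (ux)⁺.
--  3. Hence, by induction along ψ, the a- and b-overlaps of ψ(v) are A and B, and
--     |ψ(v)| + 2 = A + B.
--  4. Arithmetic: running the Stern–Brocot steps on the block word b^α₀ a^α₁ b^α₂ ⋯ follows
--     the continuant recurrence, so A + B = K[α₀+1, α₁, …, αₙ₋₁, αₙ+1].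
--  5. The integral representation of v spells v as such a block word; chaining gives |w|.

open import Defs
open import Data.Nat using (ℕ; zero; suc; _+_; _*_; _<_; _≤_; z≤n; s≤s)
open import Data.Nat.Properties
open import Data.Nat.Coprimality using (Coprime)
open import Data.Nat.Tactic.RingSolver using (solve-∀)
open import Data.List using (List; []; _∷_; _++_; length; reverse; replicate; take; foldl)
open import Data.List.Properties
  using (foldl-++; length-++; length-reverse; reverse-++; unfold-reverse; reverse-involutive;
         ++-assoc; ++-cancelˡ; ∷-injective)
open import Data.Vec using (Vec; toList; lookup) renaming ([] to []ᵥ; _∷_ to _∷ᵥ_)
open import Data.Fin using (fromℕ)
open import Data.Product using (Σ; ∃; _×_; _,_; proj₁; proj₂)
open import Data.Sum using (_⊎_; inj₁; inj₂)
open import Data.Empty using (⊥-elim)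
open import Relation.Nullary using (¬_)
open import Relation.Binary.PropositionalEquality hiding ([_])
open import Relation.Binary using (tri<; tri≈; tri>)
open import Function using (_∘_)

-- 1. Word combinatorics

[_] : Letter → Word
[ x ] = x ∷ []

++-split : (A B C D : Word) → A ++ C ≡ B ++ D → length B ≤ length A →
           ∃ λ T → A ≡ B ++ T × D ≡ T ++ C
++-split A       []      C D eq _ = A , refl , sym eq
++-split (x ∷ A) (y ∷ B) C D eq (s≤s le) with ∷-injective eq
... | refl , eq′ with ++-split A B C D eq′ le
... | T , A≡BT , D≡TC = T , cong (x ∷_) A≡BT , D≡TC

prefix-of-prefix : ∀ {z A B C D} → z ≡ A ++ C → z ≡ B ++ D → length A ≤ length B → IsPrefix A B
prefix-of-prefix {A = A} {B} {C} {D} z≡AC z≡BD le with ++-split B A D C (trans (sym z≡BD) z≡AC) le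
... | T , B≡AT , _ = T , B≡AT

++-equal-length : (A B C D : Word) → A ++ C ≡ B ++ D → length A ≡ length B → A ≡ B × C ≡ D
++-equal-length []      []      C D eq _ = refl , eq
++-equal-length (x ∷ A) (y ∷ B) C D eq len with ∷-injective eq
... | refl , eq′ with ++-equal-length A B C D eq′ (suc-injective len)
... | refl , C≡D = refl , C≡D

reverse-++-∷ : (s : Word) (x : Letter) (t : Word) → reverse (s ++ x ∷ t) ≡ reverse t ++ x ∷ reverse s
reverse-++-∷ s x t = begin
  reverse (s ++ x ∷ t)               ≡⟨ reverse-++ s (x ∷ t) ⟩
  reverse (x ∷ t) ++ reverse s       ≡⟨ cong (_++ reverse s) (unfold-reverse x t) ⟩
  (reverse t ++ [ x ]) ++ reverse s  ≡⟨ ++-assoc (reverse t) [ x ] (reverse s) ⟩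
  reverse t ++ x ∷ reverse s         ∎
  where open ≡-Reasoning

reverse-pal-++ : ∀ {u} → Palindrome u → (x : Letter) (t : Word) →
                 reverse (u ++ x ∷ t) ≡ reverse t ++ x ∷ u
reverse-pal-++ {u} pu x t = trans (reverse-++-∷ u x t) (cong (λ r → reverse t ++ x ∷ r) pu)

length-snoc : (u : Word) (x : Letter) → length (u ++ [ x ]) ≡ length u + 1
length-snoc u x = length-++ u

length-snoc-≤ : ∀ (u : Word) x {n} → length u < n → length (u ++ [ x ]) ≤ n
length-snoc-≤ u x u<n = ≤-trans (≤-reflexive (trans (length-snoc u x) (+-comm (length u) 1))) u<n

-- 2. Palindromic closure of u x for a palindrome u

-- The x-overlap n of a palindrome u: n = |s| + 2 for the longest palindrome s such that s x is a
-- prefix of u, or n = 1 if there is no such s.  (By mirror symmetry, n is the length of the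
-- longest palindromic suffix of u x.)  It is split into attainment and maximality.
OverlapAttained : Word → Letter → ℕ → Set
OverlapAttained u x n =
  n ≡ 1 ⊎ Σ Word λ s → Palindrome s × IsPrefix (s ++ [ x ]) u × n ≡ length s + 2

OverlapMaximal : Word → Letter → ℕ → Set
OverlapMaximal u x n = ∀ s → Palindrome s → IsPrefix (s ++ [ x ]) u → length s + 2 ≤ n

Overlap : Word → Letter → ℕ → Set
Overlap u x n = OverlapAttained u x n × OverlapMaximal u x n

overlap-positive : ∀ {u x n} → OverlapAttained u x n → 1 ≤ n
overlap-positive (inj₁ refl)                 = s≤s z≤n
overlap-positive (inj₂ (s , _ , _ , refl)) = ≤-trans (s≤s z≤n) (m≤n+m 2 (length s))

-- Upper bound: folding u x around its overlap gives a palindrome with prefix u x of length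
-- 2|u| + 2 − n, namely u x u if n = 1, and u x t if u = s x t with s the overlap palindrome.
closure-candidate : ∀ u x n → Palindrome u → OverlapAttained u x n →
                    Σ Word λ z′ → Palindrome z′ × IsPrefix (u ++ [ x ]) z′ ×
                                  length z′ + n ≡ length u + length u + 2
closure-candidate u x n pu (inj₁ refl) =
  u ++ x ∷ u , trans (reverse-pal-++ pu x u) (cong (_++ x ∷ u) pu) ,
  (u , sym (++-assoc u [ x ] u)) , length-eq
  where
  length-eq : length (u ++ x ∷ u) + 1 ≡ length u + length u + 2
  length-eq rewrite length-++ u {x ∷ u} = arith (length u)
    where
    arith : ∀ m → m + suc m + 1 ≡ m + m + 2
    arith = solve-∀
closure-candidate u x n pu (inj₂ (s , ps , (t , u≡sxt) , refl)) =
  u ++ x ∷ t , palindrome , (t , sym (++-assoc u [ x ] t)) , length-eq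
  where
  u≡s-x-t : u ≡ s ++ x ∷ t
  u≡s-x-t = trans u≡sxt (++-assoc s [ x ] t)
  u≡t̃-x-s : u ≡ reverse t ++ x ∷ s
  u≡t̃-x-s = trans (sym pu) (trans (cong reverse u≡s-x-t) (reverse-pal-++ ps x t))
  palindrome : reverse (u ++ x ∷ t) ≡ u ++ x ∷ t
  palindrome = begin
    reverse (u ++ x ∷ t)            ≡⟨ reverse-pal-++ pu x t ⟩
    reverse t ++ x ∷ u              ≡⟨ cong (λ r → reverse t ++ x ∷ r) u≡s-x-t ⟩
    reverse t ++ x ∷ (s ++ x ∷ t)   ≡⟨ sym (++-assoc (reverse t) (x ∷ s) (x ∷ t)) ⟩
    (reverse t ++ x ∷ s) ++ x ∷ t   ≡⟨ cong (_++ x ∷ t) (sym u≡t̃-x-s) ⟩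
    u ++ x ∷ t                      ∎
    where open ≡-Reasoning
  length-eq : length (u ++ x ∷ t) + (length s + 2) ≡ length u + length u + 2
  length-eq rewrite length-++ u {x ∷ t} | u≡s-x-t | length-++ s {x ∷ t} = arith (length s) (length t)
    where
    arith : ∀ a c → a + suc c + suc c + (a + 2) ≡ a + suc c + (a + suc c) + 2
    arith = solve-∀

short-tail-fold : ∀ u x r → Palindrome u → Palindrome (u ++ x ∷ r) → length r < length u →
                  Σ Word λ T → Palindrome T × u ≡ T ++ x ∷ r
short-tail-fold u x r pu puxr r<u
  with ++-split u (reverse r) (x ∷ r) (x ∷ u) two-readings
                (≤-trans (≤-reflexive (length-reverse r)) (<⇒≤ r<u))
  where
  two-readings : u ++ x ∷ r ≡ reverse r ++ x ∷ u
  two-readings = trans (sym puxr) (reverse-pal-++ pu x r)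
-- the overlap of the two readings is nonempty, since u = r would contradict |r| < |u|
... | [] , _ , x∷u≡x∷r = ⊥-elim (<-irrefl (cong length (sym (proj₂ (∷-injective x∷u≡x∷r)))) r<u)
... | y ∷ T , u≡r̃yT , x∷u≡yTxr with ∷-injective x∷u≡yTxr
... | refl , u≡Txr = T , T-palindrome , u≡Txr
  where
  -- u = T x r, and also u = u~ = r~ x T~ = r~ x T, so T~ = T
  T-palindrome : Palindrome T
  T-palindrome = proj₂ (∷-injective (++-cancelˡ (reverse r) _ _
    (trans (sym (reverse-++-∷ T x r)) (trans (cong reverse (sym u≡Txr)) (trans pu u≡r̃yT)))))

-- Lower bound: write a palindrome z′ with prefix u x as u x r.  If |r| < |u| it folds onto
-- u = T x r with |T| + 2 ≤ n by maximality; otherwise z′ is long enough since n ≥ 1.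
closure-lower-bound : ∀ u x n → Palindrome u → OverlapMaximal u x n → 1 ≤ n →
                      ∀ z′ → Palindrome z′ → IsPrefix (u ++ [ x ]) z′ →
                      length u + length u + 2 ≤ length z′ + n
closure-lower-bound u x n pu maximal 1≤n z′ pz′ (r , z′≡uxr) = begin
  length u + length u + 2        ≤⟨ by-tail-length (≤-<-connex (length u) (length r)) ⟩
  length u + suc (length r) + n  ≡⟨ cong (_+ n) (sym |z′|) ⟩
  length z′ + n                  ∎
  where
  open ≤-Reasoning
  z′≡u-x-r : z′ ≡ u ++ x ∷ r
  z′≡u-x-r = trans z′≡uxr (++-assoc u [ x ] r)
  |z′| : length z′ ≡ length u + suc (length r)
  |z′| = trans (cong length z′≡u-x-r) (length-++ u)
  arith-long : ∀ m → m + m + 2 ≡ m + suc m + 1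
  arith-long = solve-∀
  arith-short : ∀ a b c → a + (b + suc c) + 2 ≡ a + suc c + (b + 2)
  arith-short = solve-∀
  by-tail-length : length u ≤ length r ⊎ length r < length u →
                   length u + length u + 2 ≤ length u + suc (length r) + n
  by-tail-length (inj₁ u≤r) = begin
    length u + length u + 2        ≡⟨ arith-long (length u) ⟩
    length u + suc (length u) + 1  ≤⟨ +-mono-≤ (+-monoʳ-≤ (length u) (s≤s u≤r)) 1≤n ⟩
    length u + suc (length r) + n  ∎
  by-tail-length (inj₂ r<u) with short-tail-fold u x r pu (subst Palindrome z′≡u-x-r pz′) r<u
  ... | T , pT , u≡Txr = begin
    length u + length u + 2                     ≡⟨ cong (λ m → length u + m + 2) |u| ⟩
    length u + (length T + suc (length r)) + 2  ≡⟨ arith-short (length u) (length T) (length r) ⟩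
    length u + suc (length r) + (length T + 2)  ≤⟨ +-monoʳ-≤ (length u + suc (length r)) T-bound ⟩
    length u + suc (length r) + n               ∎
    where
    T-bound : length T + 2 ≤ n
    T-bound = maximal T pT (r , trans u≡Txr (sym (++-assoc T [ x ] r)))
    |u| : length u ≡ length T + suc (length r)
    |u| = trans (cong length u≡Txr) (length-++ T)

closure-length : ∀ u x n z → Palindrome u → Overlap u x n → IsPalClosure (u ++ [ x ]) z →
                 length z + n ≡ length u + length u + 2
closure-length u x n z pu (attained , maximal) (pz , z-prefix , z-shortest)
  with closure-candidate u x n pu attained
... | z′ , pz′ , z′-prefix , |z′| = ≤-antisym upper lower
  where
  upper : length z + n ≤ length u + length u + 2
  upper = ≤-trans (+-monoˡ-≤ n (z-shortest z′ pz′ z′-prefix)) (≤-reflexive |z′|)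
  lower : length u + length u + 2 ≤ length z + n
  lower = closure-lower-bound u x n pu maximal (overlap-positive attained) z pz z-prefix

-- A palindromic prefix s of z = (ux)⁺ followed by a letter has |s| ≤ |u|: otherwise u x would
-- be a prefix of the strictly shorter palindrome s, contradicting minimality of z.
closure-pal-prefix-short : ∀ u x z s y → IsPalClosure (u ++ [ x ]) z → Palindrome s →
                           IsPrefix (s ++ [ y ]) z → length s ≤ length u
closure-pal-prefix-short u x z s y (pz , (t₀ , z≡uxt₀) , z-shortest) ps (t , z≡syt)
  with ≤-<-connex (length s) (length u)
... | inj₁ s≤u = s≤u
... | inj₂ u<s = ⊥-elim (<-irrefl refl (<-≤-trans s<z (z-shortest s ps ux-prefix-of-s)))
  where
  z≡s-y-t : z ≡ s ++ y ∷ t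
  z≡s-y-t = trans z≡syt (++-assoc s [ y ] t)
  ux-prefix-of-s : IsPrefix (u ++ [ x ]) s
  ux-prefix-of-s = prefix-of-prefix z≡uxt₀ z≡s-y-t (length-snoc-≤ u x u<s)
  s<z : length s < length z
  s<z = <-≤-trans (m<m+n (length s) (s≤s z≤n))
                  (≤-reflexive (sym (trans (cong length z≡s-y-t) (length-++ s))))

overlap-closure-same : ∀ u x z → Palindrome u → IsPalClosure (u ++ [ x ]) z → Overlap z x (length u + 2)
overlap-closure-same u x z pu closure@(_ , ux-prefix , _) =
  inj₂ (u , pu , ux-prefix , refl) ,
  λ s ps sx-prefix → +-monoˡ-≤ 2 (closure-pal-prefix-short u x z s x closure ps sx-prefix)

-- Appending x ≠ y: the y-overlap is unchanged, since a palindrome s with s y a prefix of (ux)⁺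
-- has |s| ≤ |u|, and |s| = |u| is impossible because it would force y = x.
overlap-closure-other : ∀ u x z y m → ¬ x ≡ y → IsPalClosure (u ++ [ x ]) z →
                        Overlap u y m → Overlap z y m
overlap-closure-other u x z y m x≢y closure@(_ , (t₀ , z≡uxt₀) , _) (attained , maximal) =
  extend attained , bound
  where
  z≡u-x-t₀ : z ≡ u ++ x ∷ t₀
  z≡u-x-t₀ = trans z≡uxt₀ (++-assoc u [ x ] t₀)
  extend : OverlapAttained u y m → OverlapAttained z y m
  extend (inj₁ m≡1) = inj₁ m≡1
  extend (inj₂ (s , ps , (t , u≡syt) , m≡)) = inj₂ (s , ps , (t ++ x ∷ t₀ , z≡sy-t-x-t₀) , m≡)
    where
    z≡sy-t-x-t₀ : z ≡ (s ++ [ y ]) ++ t ++ x ∷ t₀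
    z≡sy-t-x-t₀ = trans z≡u-x-t₀ (trans (cong (_++ x ∷ t₀) u≡syt) (++-assoc (s ++ [ y ]) t (x ∷ t₀)))
  bound : OverlapMaximal z y m
  bound s ps (t , z≡syt) with <-cmp (length s) (length u)
  ... | tri< s<u _ _ = maximal s ps (prefix-of-prefix z≡syt z≡u-x-t₀ (length-snoc-≤ s y s<u))
  ... | tri≈ _ s≡u _ = ⊥-elim (x≢y (sym (proj₁ (∷-injective y∷t≡x∷t₀))))
    where
    y∷t≡x∷t₀ : y ∷ t ≡ x ∷ t₀
    y∷t≡x∷t₀ = proj₂ (++-equal-length s u (y ∷ t) (x ∷ t₀)
                 (trans (sym (trans z≡syt (++-assoc s [ y ] t))) z≡u-x-t₀) s≡u)
  ... | tri> _ _ u<s = ⊥-elim (<⇒≱ u<s (closure-pal-prefix-short u x z s y closure ps (t , z≡syt)))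

-- 3. The overlaps along ψ

sbStep : Letter → ℕ × ℕ → ℕ × ℕ
sbStep a (A , B) = (A + B , B)
sbStep b (A , B) = (A , A + B)

sbRun : ℕ × ℕ → Word → ℕ × ℕ
sbRun = foldl (λ P x → sbStep x P)

-- The quantity |ψ(v)| + 2 will be the sum of the two components.
total : ℕ × ℕ → ℕ
total (A , B) = A + B

PsiInvariant : Word → ℕ × ℕ → Set
PsiInvariant u (A , B) = Palindrome u × length u + 2 ≡ A + B × Overlap u a A × Overlap u b B

new-length : ∀ Z U A B → Z + A ≡ U + U + 2 → U + 2 ≡ A + B → Z + 2 ≡ A + B + B
new-length Z U A B |z| |u| = +-cancelʳ-≡ A _ _ (begin
  Z + 2 + A          ≡⟨ arith₁ Z A ⟩
  (Z + A) + 2        ≡⟨ cong (_+ 2) |z| ⟩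
  U + U + 2 + 2      ≡⟨ arith₂ U ⟩
  (U + 2) + (U + 2)  ≡⟨ cong₂ _+_ |u| |u| ⟩
  (A + B) + (A + B)  ≡⟨ arith₃ A B ⟩
  A + B + B + A      ∎)
  where
  open ≡-Reasoning
  arith₁ : ∀ z a → z + 2 + a ≡ (z + a) + 2
  arith₁ = solve-∀
  arith₂ : ∀ u → u + u + 2 + 2 ≡ (u + 2) + (u + 2)
  arith₂ = solve-∀
  arith₃ : ∀ a b → (a + b) + (a + b) ≡ a + b + b + a
  arith₃ = solve-∀

psi-invariant-step : ∀ u x z P → PsiInvariant u P → IsPalClosure (u ++ [ x ]) z →
                     PsiInvariant z (sbStep x P)
psi-invariant-step u a z (A , B) (pu , |u| , overlap-a , overlap-b) closure =
  proj₁ closure ,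
  new-length (length z) (length u) A B (closure-length u a A z pu overlap-a closure) |u| ,
  subst (Overlap z a) |u| (overlap-closure-same u a z pu closure) ,
  overlap-closure-other u a z b B (λ ()) closure overlap-b
psi-invariant-step u b z (A , B) (pu , |u| , overlap-a , overlap-b) closure =
  proj₁ closure ,
  trans (new-length (length z) (length u) B A (closure-length u b B z pu overlap-b closure)
                    (trans |u| (+-comm A B)))
        (arith A B) ,
  overlap-closure-other u b z a A (λ ()) closure overlap-a ,
  subst (Overlap z b) |u| (overlap-closure-same u b z pu closure)
  where
  arith : ∀ a b → b + a + a ≡ a + (a + b)
  arith = solve-∀

overlap-empty : ∀ x → Overlap [] x 1
overlap-empty x = inj₁ refl , no-prefix
  where
  no-prefix : OverlapMaximal [] x 1
  no-prefix []      _ (_ , ())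
  no-prefix (_ ∷ _) _ (_ , ())

psi-invariant : ∀ {v u} → IsPsi v u → PsiInvariant u (sbRun (1 , 1) v)
psi-invariant psi-ε = refl , refl , overlap-empty a , overlap-empty b
psi-invariant (psi-step {v} {u} {z} x ψv≡u closure) =
  subst (PsiInvariant z) (sym (foldl-++ (λ P y → sbStep y P) (1 , 1) v [ x ]))
        (psi-invariant-step u x z (sbRun (1 , 1) v) (psi-invariant ψv≡u) closure)

psi-length : ∀ {v u} → IsPsi v u → length u + 2 ≡ total (sbRun (1 , 1) v)
psi-length ψv≡u = proj₁ (proj₂ (psi-invariant ψv≡u))

-- 4. Stern–Brocot steps on block words follow the continuant recurrence

contPair : ℕ → ℕ → List ℕ → ℕ × ℕ
contPair p q []       = (p , q)
contPair p q (c ∷ cs) = contPair q (c * q + p) cs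

contPair-snoc : ∀ xs c p q → contPair p q (xs ++ c ∷ []) ≡
                (proj₂ (contPair p q xs) , c * proj₂ (contPair p q xs) + proj₁ (contPair p q xs))
contPair-snoc []       c p q = refl
contPair-snoc (d ∷ xs) c p q = contPair-snoc xs c q (d * q + p)

-- Continuants are the second component of the pair seeded with (0 , 1).  Since Krev reads lists
-- backwards, the pair statement is proved for reverse ys by induction on ys; its first component
-- is the continuant of the list without its last entry (0 for the empty list).
Kdrop : List ℕ → ℕ
Kdrop []       = 0
Kdrop (_ ∷ rs) = Krev rs

Krev-contPair : ∀ ys → contPair 0 1 (reverse ys) ≡ (Kdrop ys , Krev ys)
Krev-contPair []           = refl
Krev-contPair (x ∷ [])     = cong (1 ,_) (trans (+-identityʳ (x * 1)) (*-identityʳ x))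
Krev-contPair (x ∷ y ∷ rs) = begin
  contPair 0 1 (reverse (x ∷ y ∷ rs))
    ≡⟨ cong (contPair 0 1) (unfold-reverse x (y ∷ rs)) ⟩
  contPair 0 1 (reverse (y ∷ rs) ++ x ∷ [])
    ≡⟨ contPair-snoc (reverse (y ∷ rs)) x 0 1 ⟩
  (proj₂ P , x * proj₂ P + proj₁ P)
    ≡⟨ cong (λ Q → proj₂ Q , x * proj₂ Q + proj₁ Q) (Krev-contPair (y ∷ rs)) ⟩
  (Krev (y ∷ rs) , x * Krev (y ∷ rs) + Krev rs) ∎
  where
  open ≡-Reasoning
  P : ℕ × ℕ
  P = contPair 0 1 (reverse (y ∷ rs))

K-contPair : ∀ xs → K xs ≡ proj₂ (contPair 0 1 xs)
K-contPair xs = begin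
  Krev (reverse xs)
    ≡⟨ cong proj₂ (sym (Krev-contPair (reverse xs))) ⟩
  proj₂ (contPair 0 1 (reverse (reverse xs)))
    ≡⟨ cong (λ ys → proj₂ (contPair 0 1 ys)) (reverse-involutive xs) ⟩
  proj₂ (contPair 0 1 xs) ∎
  where open ≡-Reasoning

-- Incrementing the last entry adds the previous continuant: K[…, c+1] = K[…, c] + K[…].
contPair-bumpLast : ∀ ys y p q → proj₂ (contPair p q (bumpLast y ys)) ≡ total (contPair p q (y ∷ ys))
contPair-bumpLast []       y p q = +-assoc q (y * q) p
contPair-bumpLast (z ∷ zs) y p q = contPair-bumpLast zs z q (y * q + p)

K-contArgs : ∀ α₀ αs → K (contArgs α₀ αs) ≡ total (contPair 1 1 (α₀ ∷ αs))
K-contArgs α₀ αs = trans (K-contPair (contArgs α₀ αs)) (shifted αs)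
  where
  arith₁ : ∀ a → 1 * (suc a * 1 + 0) + 1 ≡ 1 + (a * 1 + 1)
  arith₁ = solve-∀
  arith₂ : ∀ a → suc a * 1 + 0 ≡ a * 1 + 1
  arith₂ = solve-∀
  shifted : ∀ αs → proj₂ (contPair 0 1 (contArgs α₀ αs)) ≡ total (contPair 1 1 (α₀ ∷ αs))
  shifted []       = arith₁ α₀
  shifted (y ∷ ys) = trans (contPair-bumpLast ys y 1 (suc α₀ * 1 + 0))
                           (cong (λ c → total (contPair 1 c (y ∷ ys))) (arith₂ α₀))

-- The Stern–Brocot pair seen from the letter x: its own component first.
orient : Letter → ℕ × ℕ → ℕ × ℕ
orient a (p , q) = (p , q)
orient b (p , q) = (q , p)

total-orient : ∀ x p q → total (orient x (p , q)) ≡ p + q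
total-orient a p q = refl
total-orient b p q = +-comm q p

sbStep-orient : ∀ x p q → sbStep x (orient x (p , q)) ≡ orient x (p + q , q)
sbStep-orient a p q = refl
sbStep-orient b p q = cong (q ,_) (+-comm q p)

sbRun-block : ∀ x k p q → sbRun (orient x (p , q)) (replicate k x) ≡ orient (flipL x) (q , k * q + p)
sbRun-block a zero    p q = refl
sbRun-block b zero    p q = refl
sbRun-block x (suc k) p q = begin
  sbRun (sbStep x (orient x (p , q))) (replicate k x)
    ≡⟨ cong (λ P → sbRun P (replicate k x)) (sbStep-orient x p q) ⟩
  sbRun (orient x (p + q , q)) (replicate k x)
    ≡⟨ sbRun-block x k (p + q) q ⟩
  orient (flipL x) (q , k * q + (p + q))
    ≡⟨ cong (λ m → orient (flipL x) (q , m)) (arith k p q) ⟩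
  orient (flipL x) (q , suc k * q + p) ∎
  where
  open ≡-Reasoning
  arith : ∀ k p q → k * q + (p + q) ≡ q + k * q + p
  arith = solve-∀

sbRun-expand : ∀ cs x p q → total (sbRun (orient x (p , q)) (expandFrom x cs)) ≡ total (contPair p q cs)
sbRun-expand []       x p q = total-orient x p q
sbRun-expand (k ∷ cs) x p q = begin
  total (sbRun (orient x (p , q)) (replicate k x ++ expandFrom (flipL x) cs))
    ≡⟨ cong total (foldl-++ (λ P y → sbStep y P) (orient x (p , q)) (replicate k x) _) ⟩
  total (sbRun (sbRun (orient x (p , q)) (replicate k x)) (expandFrom (flipL x) cs))
    ≡⟨ cong (λ P → total (sbRun P (expandFrom (flipL x) cs))) (sbRun-block x k p q) ⟩
  total (sbRun (orient (flipL x) (q , k * q + p)) (expandFrom (flipL x) cs))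
    ≡⟨ sbRun-expand cs (flipL x) q (k * q + p) ⟩
  total (contPair q (k * q + p) cs) ∎
  where open ≡-Reasoning

-- 5. The integral representation spells v as a block word

expandFrom-trailing-zero : ∀ x cs → expandFrom x (cs ++ 0 ∷ []) ≡ expandFrom x cs
expandFrom-trailing-zero x []       = refl
expandFrom-trailing-zero x (k ∷ cs) = cong (replicate k x ++_) (expandFrom-trailing-zero (flipL x) cs)

toList-last : ∀ m (β : Vec ℕ (suc m)) → toList β ≡ take m (toList β) ++ lookup β (fromℕ m) ∷ []
toList-last zero    (c ∷ᵥ []ᵥ) = refl
toList-last (suc m) (c ∷ᵥ β)   = cong (c ∷_) (toList-last m β)

integralRep-expand : ∀ {v αs} → IntegralRep v αs → v ≡ expandFrom b αs
integralRep-expand (m , β , (_ , _ , v≡β) , inj₁ (_ , αs≡β)) = trans v≡β (cong (expandFrom b) (sym αs≡β))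
integralRep-expand {v} {αs} (m , β , (_ , _ , v≡β) , inj₂ (βₘ≡0 , αs≡β′)) = begin
  v                                                    ≡⟨ v≡β ⟩
  expandFrom b (toList β)                              ≡⟨ cong (expandFrom b) (toList-last m β) ⟩
  expandFrom b (take m (toList β) ++ lookup β (fromℕ m) ∷ [])
    ≡⟨ cong (λ k → expandFrom b (take m (toList β) ++ k ∷ [])) βₘ≡0 ⟩
  expandFrom b (take m (toList β) ++ 0 ∷ [])
    ≡⟨ expandFrom-trailing-zero b (take m (toList β)) ⟩
  expandFrom b (take m (toList β))                     ≡⟨ cong (expandFrom b) (sym αs≡β′) ⟩
  expandFrom b αs                                      ∎
  where open ≡-Reasoning

theorem5p2 : (p q : ℕ) → 0 < p → 0 < q → Coprime p q →
             (w : Word) → w ≡ christoffel p q →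
             (u v : Word) → IsPsi v u → w ≡ a ∷ (u ++ b ∷ []) →
             (α₀ : ℕ) (αs : List ℕ) → IntegralRep v (α₀ ∷ αs) →
             length w ≡ K (contArgs α₀ αs)
theorem5p2 _ _ _ _ _ w _ u v ψv≡u w≡aub α₀ αs rep = begin
  length w                                        ≡⟨ cong length w≡aub ⟩
  suc (length (u ++ b ∷ []))                      ≡⟨ cong suc (length-snoc u b) ⟩
  suc (length u + 1)                              ≡⟨ sym (+-suc (length u) 1) ⟩
  length u + 2                                    ≡⟨ psi-length ψv≡u ⟩
  total (sbRun (1 , 1) v)                         ≡⟨ cong (total ∘ sbRun (1 , 1)) (integralRep-expand rep) ⟩
  total (sbRun (1 , 1) (expandFrom b (α₀ ∷ αs)))  ≡⟨ sbRun-expand (α₀ ∷ αs) b 1 1 ⟩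
  total (contPair 1 1 (α₀ ∷ αs))                  ≡⟨ sym (K-contArgs α₀ αs) ⟩
  K (contArgs α₀ αs)                              ∎
  where open ≡-Reasoning
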